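{- Let $q$ be a prime power, $n$ a positive integer coprime to $q$, $\gamma\in\mathbb{Z}/n\mathbb{Z}$, $n_\gamma=n/\gcd(\gamma,n)$, $\tau=|c_{n/q}(\gamma)|$ and $t$ a positive integer. Then every $q^t$-cyclotomic coset modulo $n$ contained in $c_{n/q}(\gamma)$ is of equal difference if and only if (i) $\mathrm{rad}(n_\gamma)\mid q^t-1$ and (ii) $q^t\equiv1\pmod4$ whenever $8\mid n_\gamma$. In this case the $q^t$-cyclotomic decomposition $c_{n/q}(\gamma)=\bigsqcup_{j=0}^{t'-1}c_{n/q^t}(\gamma q^j)$, with $t'=\gcd(t,\tau)$, is an equal-difference decomposition of $c_{n/q}(\gamma)$.
   Context: For $N$ coprime to $n$ (e.g. $N=q^t$), $c_{n/N}(\beta)=\{\beta,\beta N,\dots,\beta N^{\sigma-1}\}\subseteq\mathbb{Z}/n\mathbb{Z}$ with $\sigma$ least positive such that $\beta N^\sigma\equiv\beta\pmod n$; it is of equal difference if $\sigma\mid n$ and $c_{n/N}(\beta)=\{\beta,\beta+\frac n\sigma,\dots,\beta+(\sigma-1)\frac n\sigma\}$ in $\mathbb{Z}/n\mathbb{Z}$ (one-element cosets included). An equal-difference decomposition of $c_{n/q}(\gamma)$ is a partition of it into disjoint subsets $E$ each satisfying $|E|\mid n$ and $E=\{e,e+\frac n{|E|},\dots,e+(|E|-1)\frac n{|E|}\}$ for some $e\in E$. $\mathrm{rad}(m)$ is the product of distinct primes dividing $m$. -}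

module Defs where

open import Data.Nat using (ℕ; zero; suc; _+_; _*_; _∸_; _^_; _<_; NonZero)
open import Data.Nat.DivMod using (_%_)
open import Data.Nat.Divisibility using (_∣_; _∣?_)
open import Data.Nat.Primality using (Prime; prime?)
open import Data.List using (map; upTo)
open import Data.Nat.ListAction using (product)
open import Data.Product using (Σ; ∃; ∃-syntax; _×_)
open import Data.Bool using (if_then_else_; _∧_)
open import Relation.Nullary using (¬_)
open import Relation.Nullary.Decidable using (⌊_⌋)
open import Relation.Binary.PropositionalEquality using (_≡_)
open import Function.Bundles using (_⇔_)

-- Subsets of ℤ/nℤ are represented as predicates on ℕ (representatives);
-- all predicates below only depend on x % n.
Subset : Set₁
Subset = ℕ → Set

IsPrimePower : ℕ → Set
IsPrimePower q = ∃[ p ] ∃[ e ] (Prime p × 0 < e × q ≡ p ^ e)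

rad : ℕ → ℕ
rad m = product (map (λ p → if ⌊ prime? p ⌋ ∧ ⌊ p ∣? m ⌋ then p else 1) (upTo (suc m)))

Coset : (n : ℕ) → .{{NonZero n}} → ℕ → ℕ → Subset
Coset n N β x = ∃[ k ] ((β * N ^ k) % n ≡ x % n)

IsOrder : (n : ℕ) → .{{NonZero n}} → ℕ → ℕ → ℕ → Set
IsOrder n N β σ =
  0 < σ × ((β * N ^ σ) % n ≡ β % n)
  × (∀ s → 0 < s → s < σ → ¬ ((β * N ^ s) % n ≡ β % n))

EqualDiffCoset : (n : ℕ) → .{{NonZero n}} → ℕ → ℕ → Set
EqualDiffCoset n N β =
  ∃[ σ ] (IsOrder n N β σ × (∃[ d ] (n ≡ d * σ ×
    (∀ x → Coset n N β x ⇔ (∃[ i ] (i < σ × (β + i * d) % n ≡ x % n))))))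

-- E ⊆ ℤ/nℤ is equal-difference: E = {e + i (n/s) : 0 ≤ i < s} for some e ∈ E,
-- with s ∣ n (n = d * s). These s elements are distinct mod n, so s = |E|.
EqualDiffSet : (n : ℕ) → .{{NonZero n}} → Subset → Set
EqualDiffSet n E =
  ∃[ s ] (0 < s × (∃[ d ] (n ≡ d * s × (∃[ e ] (E e ×
    (∀ x → E x ⇔ (∃[ i ] (i < s × (e + i * d) % n ≡ x % n))))))))

EqualDiffDecomposition : (n : ℕ) → .{{NonZero n}} → Subset → ℕ → (ℕ → Subset) → Set
EqualDiffDecomposition n C m E =
  (∀ x → C x ⇔ (∃[ j ] (j < m × E j x)))
  × (∀ j j′ x → j < m → j′ < m → E j x → E j′ x → j ≡ j′)
  × (∀ j → j < m → EqualDiffSet n (E j))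

{-# OPTIONS --safe #-}
-- Write g = gcd(γ, n), m = n / g and γ = g·u with u a unit modulo m. For β ≡ γ qʲ (mod n),
-- β·a ≡ β·b (mod n) iff a ≡ b (mod m), so the q^t-coset of β is governed by the powers of
-- Q = q^t modulo m.
--
-- Sufficiency. Put x = Q − 1, D = gcd(x, m), e = m / D. By (i) every prime r ∣ e divides x,
-- hence D, and rD ∤ x since rD ∣ m; by (ii), 4 ∣ x when 8 ∣ m. Lifting the exponent one prime
-- factor p of e at a time, (x, D, e) ↦ ((1 + x)^p − 1, pD, e / p), shows that
-- Q has order e modulo m and that its powers are exactly the residues ≡ 1 (mod D). Hence the
-- coset of β is β + gDℤ, of size e, an equal-difference coset.
--
-- Necessity. If the Q-coset of γ is γ + dℤ with n = dσ, then d = g·d′, m = d′σ and the powers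
-- u·Qᵏ fill the progression u + d′ℤ modulo m. A prime p ∣ m not dividing d′ would place a
-- multiple of p, i.e. a non-unit, among them; so rad m ∣ d′, and u·Q ≡ u (mod N) for every
-- common divisor N of m and d′ gives (i). If 8 ∣ m but 4 ∤ d′, then u, u + d′, u + 2d′ are
-- distinct modulo 8, while odd powers take only two values modulo 8.
--
-- Decomposition. q^i ≡ q^j (mod m) iff i ≡ j (mod τ), and t generates gcd(t, τ)ℤ modulo τ, so
-- the q^t-cosets of γ q^j, j < gcd(t, τ), partition the q-coset of γ.
module Submission where

open import Data.Bool using (if_then_else_; _∧_)
open import Data.Empty using (⊥-elim)
open import Data.List using ([]; _∷_; map; upTo; _∷ʳ_; [_])
open import Data.List.Properties using (upTo-∷ʳ; map-++)
open import Data.List.Relation.Unary.All using (All)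
import Data.List.Relation.Unary.All as All
open import Data.Nat
open import Data.Nat.Coprimality using (Coprime; coprime-Bézout)
import Data.Nat.Coprimality as Coprimality
open import Data.Nat.DivMod
open import Data.Nat.Divisibility
open import Data.Nat.GCD
  using (gcd; gcd[m,n]∣m; gcd[m,n]∣n; gcd[m,n]≢0; gcd-greatest; gcd-GCD; n/gcd[m,n]≢0; module Bézout)
open import Data.Nat.ListAction using (product)
open import Data.Nat.ListAction.Properties using (product-++)
open import Data.Nat.Primality
  using ( Prime; prime?; prime[2]; ¬prime[1]; prime⇒nonZero; prime⇒nonTrivial; prime⇒irreducible
        ; euclidsLemma; productOfPrimes≢0)
open import Data.Nat.Primality.Factorisation using (PrimeFactorisation; factorise)
open import Data.Nat.Properties
open import Algebra.Properties.CommutativeSemigroup *-commutativeSemigroup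
  using (xy∙z≈y∙xz; x∙yz≈y∙xz; xy∙z≈x∙zy; x∙yz≈z∙xy)
open import Data.Nat.Tactic.RingSolver using (solve-∀; solve)
open import Data.Product using (∃-syntax; _×_; _,_; proj₁; proj₂; map₂; uncurry)
open import Data.Sum using (_⊎_; inj₁; inj₂; [_,_]′)
open import Function.Base using (_∘_; _∘′_; id)
open import Function.Bundles using (_⇔_; mk⇔; Equivalence)
open import Relation.Binary.Bundles using (Setoid)
open import Relation.Binary.PropositionalEquality hiding ([_])
import Relation.Binary.Reasoning.Setoid
open import Relation.Nullary using (¬_; contradiction; yes; no)
open import Relation.Nullary.Decidable using (⌊_⌋)

open import Defs

infix 4 _≡_[mod_]

-- Stated without subtraction, so that it is usable in ℕ; the modulus 0 is allowed.
record _≡_[mod_] (a b m : ℕ) : Set where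
  constructor congruent
  field
    k l : ℕ
    eq  : a + k * m ≡ b + l * m

module _ {m : ℕ} where

  mod-refl : ∀ {a} → a ≡ a [mod m ]
  mod-refl = congruent 0 0 refl

  ≡⇒≡-mod : ∀ {a b} → a ≡ b → a ≡ b [mod m ]
  ≡⇒≡-mod refl = mod-refl

  mod-sym : ∀ {a b} → a ≡ b [mod m ] → b ≡ a [mod m ]
  mod-sym (congruent k l eq) = congruent l k (sym eq)

  mod-trans : ∀ {a b c} → a ≡ b [mod m ] → b ≡ c [mod m ] → a ≡ c [mod m ]
  mod-trans {a} {b} {c} (congruent k l eq) (congruent k′ l′ eq′) = congruent (k + k′) (l′ + l) (begin
    a + (k + k′) * m      ≡⟨ solve (a ∷ k ∷ k′ ∷ m ∷ []) ⟩
    (a + k * m) + k′ * m  ≡⟨ cong (_+ k′ * m) eq ⟩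
    (b + l * m) + k′ * m  ≡⟨ solve (b ∷ l ∷ k′ ∷ m ∷ []) ⟩
    (b + k′ * m) + l * m  ≡⟨ cong (_+ l * m) eq′ ⟩
    (c + l′ * m) + l * m  ≡⟨ solve (c ∷ l′ ∷ l ∷ m ∷ []) ⟩
    c + (l′ + l) * m      ∎)
    where open ≡-Reasoning

mod-setoid : ℕ → Setoid _ _
mod-setoid m = record
  { Carrier       = ℕ
  ; _≈_           = _≡_[mod m ]
  ; isEquivalence = record { refl = mod-refl ; sym = mod-sym ; trans = mod-trans }
  }

module ≡-mod-Reasoning (m : ℕ) = Relation.Binary.Reasoning.Setoid (mod-setoid m)

module _ {m : ℕ} where

  +-cong-mod : ∀ {a b c d} → a ≡ b [mod m ] → c ≡ d [mod m ] → a + c ≡ b + d [mod m ]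
  +-cong-mod {a} {b} {c} {d} (congruent k l eq) (congruent k′ l′ eq′) = congruent (k + k′) (l + l′) (begin
    a + c + (k + k′) * m          ≡⟨ solve (a ∷ c ∷ k ∷ k′ ∷ m ∷ []) ⟩
    (a + k * m) + (c + k′ * m)    ≡⟨ cong₂ _+_ eq eq′ ⟩
    (b + l * m) + (d + l′ * m)    ≡⟨ solve (b ∷ d ∷ l ∷ l′ ∷ m ∷ []) ⟩
    b + d + (l + l′) * m          ∎)
    where open ≡-Reasoning

  *-congˡ-mod : ∀ c {a b} → a ≡ b [mod m ] → c * a ≡ c * b [mod m ]
  *-congˡ-mod c {a} {b} (congruent k l eq) = congruent (c * k) (c * l) (begin
    c * a + c * k * m  ≡⟨ solve (c ∷ a ∷ k ∷ m ∷ []) ⟩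
    c * (a + k * m)    ≡⟨ cong (c *_) eq ⟩
    c * (b + l * m)    ≡⟨ solve (c ∷ b ∷ l ∷ m ∷ []) ⟩
    c * b + c * l * m  ∎)
    where open ≡-Reasoning

  *-congʳ-mod : ∀ c {a b} → a ≡ b [mod m ] → a * c ≡ b * c [mod m ]
  *-congʳ-mod c {a} {b} eq = subst₂ _≡_[mod m ] (*-comm c a) (*-comm c b) (*-congˡ-mod c eq)

  *-cong-mod : ∀ {a b c d} → a ≡ b [mod m ] → c ≡ d [mod m ] → a * c ≡ b * d [mod m ]
  *-cong-mod {b = b} {c} a≡b c≡d = mod-trans (*-congʳ-mod c a≡b) (*-congˡ-mod b c≡d)

  ^-cong-mod : ∀ {a b} k → a ≡ b [mod m ] → a ^ k ≡ b ^ k [mod m ]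
  ^-cong-mod zero    a≡b = mod-refl
  ^-cong-mod (suc k) a≡b = *-cong-mod a≡b (^-cong-mod k a≡b)

  +-cancelˡ-mod : ∀ a {b c} → a + b ≡ a + c [mod m ] → b ≡ c [mod m ]
  +-cancelˡ-mod a {b} {c} (congruent k l eq) = congruent k l
    (+-cancelˡ-≡ a _ _ (trans (sym (+-assoc a b (k * m))) (trans eq (+-assoc a c (l * m)))))

  +-*-mod : ∀ a k → a + k * m ≡ a [mod m ]
  +-*-mod a k = congruent 0 k (+-identityʳ _)

  ∣⇒≡0-mod : ∀ {a} → m ∣ a → a ≡ 0 [mod m ]
  ∣⇒≡0-mod (divides k refl) = +-*-mod 0 k

  ≡0-mod⇒∣ : ∀ {a} → a ≡ 0 [mod m ] → m ∣ a
  ≡0-mod⇒∣ {a} (congruent k l eq) =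
    ∣m+n∣m⇒∣n (subst (m ∣_) (trans (sym eq) (+-comm a (k * m))) (n∣m*n l)) (n∣m*n k)

  ≡1-mod⇒∣ : ∀ {a} → suc a ≡ 1 [mod m ] → m ∣ a
  ≡1-mod⇒∣ h = ≡0-mod⇒∣ (+-cancelˡ-mod 1 h)

  ∣⇒≡1-mod : ∀ {a} → m ∣ a → suc a ≡ 1 [mod m ]
  ∣⇒≡1-mod h = +-cong-mod (mod-refl {a = 1}) (∣⇒≡0-mod h)

  %-mod : ∀ a → .{{_ : NonZero m}} → a % m ≡ a [mod m ]
  %-mod a = mod-sym (subst (_≡ a % m [mod m ]) (sym (m≡m%n+[m/n]*n a m)) (+-*-mod (a % m) (a / m)))

  %≡⇒≡-mod : ∀ {a b} → .{{_ : NonZero m}} → a % m ≡ b % m → a ≡ b [mod m ]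
  %≡⇒≡-mod {a} {b} eq = mod-trans (mod-sym (%-mod a)) (subst (_≡ b [mod m ]) (sym eq) (%-mod b))

  ≡-mod⇒%≡ : ∀ {a b} → .{{_ : NonZero m}} → a ≡ b [mod m ] → a % m ≡ b % m
  ≡-mod⇒%≡ {a} {b} (congruent k l eq) =
    trans (sym ([m+kn]%n≡m%n a k m)) (trans (cong (_% m) eq) ([m+kn]%n≡m%n b l m))

∣⇒+-≡-mod : ∀ {m} a {d} → m ∣ d → a + d ≡ a [mod m ]
∣⇒+-≡-mod {m} a {d} m∣d =
  subst (a + d ≡_[mod m ]) (+-identityʳ a) (+-cong-mod (mod-refl {a = a}) (∣⇒≡0-mod m∣d))

mod-∣-weaken : ∀ {d m a b} → d ∣ m → a ≡ b [mod m ] → a ≡ b [mod d ]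
mod-∣-weaken {d} {a = a} {b} (divides r refl) (congruent k l eq) = congruent (k * r) (l * r) (begin
  a + k * r * d    ≡⟨ cong (a +_) (*-assoc k r d) ⟩
  a + k * (r * d)  ≡⟨ eq ⟩
  b + l * (r * d)  ≡⟨ cong (b +_) (*-assoc l r d) ⟨
  b + l * r * d    ∎)
  where open ≡-Reasoning

*-scale-mod : ∀ g {m a b} → a ≡ b [mod m ] → g * a ≡ g * b [mod g * m ]
*-scale-mod g {m} {a} {b} (congruent k l eq) = congruent k l (begin
  g * a + k * (g * m)  ≡⟨ solve (g ∷ a ∷ k ∷ m ∷ []) ⟩
  g * (a + k * m)      ≡⟨ cong (g *_) eq ⟩
  g * (b + l * m)      ≡⟨ solve (g ∷ b ∷ l ∷ m ∷ []) ⟩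
  g * b + l * (g * m)  ∎)
  where open ≡-Reasoning

*-unscale-mod : ∀ g {m a b} → .{{_ : NonZero g}} → g * a ≡ g * b [mod g * m ] → a ≡ b [mod m ]
*-unscale-mod g {m} {a} {b} (congruent k l eq) = congruent k l (*-cancelˡ-≡ _ _ g (begin
  g * (a + k * m)      ≡⟨ solve (g ∷ a ∷ k ∷ m ∷ []) ⟩
  g * a + k * (g * m)  ≡⟨ eq ⟩
  g * b + l * (g * m)  ≡⟨ solve (g ∷ b ∷ l ∷ m ∷ []) ⟩
  g * (b + l * m)      ∎))
  where open ≡-Reasoning

∣-resp-mod : ∀ {d m a b} → d ∣ m → a ≡ b [mod m ] → d ∣ a → d ∣ b
∣-resp-mod d∣m a≡b d∣a = ≡0-mod⇒∣ (mod-trans (mod-sym (mod-∣-weaken d∣m a≡b)) (∣⇒≡0-mod d∣a))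

≡1-mod⇒∣∸1 : ∀ {N Q} → .{{_ : NonZero Q}} → Q ≡ 1 [mod N ] → N ∣ Q ∸ 1
≡1-mod⇒∣∸1 {Q = Q} Q≡1 = ≡1-mod⇒∣ (subst (_≡ 1 [mod _ ]) (sym (suc-pred Q)) Q≡1)

record Invertible (m a : ℕ) : Set where
  constructor invertible
  field
    inverse   : ℕ
    *-inverse : a * inverse ≡ 1 [mod m ]

coprime⇒invertible : ∀ {m a} → Coprime m a → Invertible m a
coprime⇒invertible {m} {a} cop with coprime-Bézout cop
... | Bézout.-+ x y eq = invertible y (congruent 0 x (trans (+-identityʳ _) (trans (*-comm a y) (sym eq))))
coprime⇒invertible {zero}  {a} cop | Bézout.+- x y eq = ⊥-elim (1+n≢0 (trans eq (*-zeroʳ x)))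
coprime⇒invertible {suc m} {a} cop | Bézout.+- x y eq = invertible (y * m) (congruent x (a * y) (begin
  a * (y * m) + x * suc m    ≡⟨ cong (a * (y * m) +_) eq ⟨
  a * (y * m) + (1 + y * a)  ≡⟨ solve (a ∷ y ∷ m ∷ []) ⟩
  1 + a * y * suc m          ∎))
  where open ≡-Reasoning

prime∤⇒invertible : ∀ {p a} → Prime p → p ∤ a → Invertible p a
prime∤⇒invertible {p} pp p∤a = coprime⇒invertible p-coprime
  where
  p-coprime : Coprime p _
  p-coprime (d∣p , d∣a) with prime⇒irreducible pp d∣p
  ... | inj₁ d≡1 = d≡1
  ... | inj₂ refl = contradiction d∣a p∤a

module _ {m : ℕ} where

  *-invertible : ∀ {a b} → Invertible m a → Invertible m b → Invertible m (a * b)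
  *-invertible {a} {b} (invertible w aw≡1) (invertible v bv≡1) = invertible (w * v) (begin
    a * b * (w * v)  ≡⟨ [m*n]*[o*p]≡[m*o]*[n*p] a b w v ⟩
    a * w * (b * v)  ≈⟨ *-cong-mod aw≡1 bv≡1 ⟩
    1                ∎)
    where open ≡-mod-Reasoning m

  ^-invertible : ∀ {a} k → Invertible m a → Invertible m (a ^ k)
  ^-invertible zero    _   = invertible 1 mod-refl
  ^-invertible {a} (suc k) inv = *-invertible {a} {a ^ k} inv (^-invertible k inv)

  *-cancelˡ-mod : ∀ {c a b} → Invertible m c → c * a ≡ c * b [mod m ] → a ≡ b [mod m ]
  *-cancelˡ-mod {c} {a} {b} (invertible w cw≡1) ca≡cb = begin
    a            ≡⟨ *-identityˡ a ⟨
    1 * a        ≈⟨ *-congʳ-mod a cw≡1 ⟨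
    c * w * a    ≡⟨ solve (c ∷ w ∷ a ∷ []) ⟩
    w * (c * a)  ≈⟨ *-congˡ-mod w ca≡cb ⟩
    w * (c * b)  ≡⟨ solve (c ∷ w ∷ b ∷ []) ⟩
    c * w * b    ≈⟨ *-congʳ-mod b cw≡1 ⟩
    1 * b        ≡⟨ *-identityˡ b ⟩
    b            ∎
    where open ≡-mod-Reasoning m

invertible-∣-weaken : ∀ {d m a} → d ∣ m → Invertible m a → Invertible d a
invertible-∣-weaken d∣m (invertible w aw≡1) = invertible w (mod-∣-weaken d∣m aw≡1)


invertible-∣⇒∣1 : ∀ {N a} → Invertible N a → N ∣ a → N ∣ 1
invertible-∣⇒∣1 {N} {a} (invertible w aw≡1) N∣a = ≡0-mod⇒∣ (begin
  1      ≈⟨ aw≡1 ⟨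
  a * w  ≈⟨ *-congʳ-mod w (∣⇒≡0-mod N∣a) ⟩
  0      ∎)
  where open ≡-mod-Reasoning N

prime∤invertible : ∀ {p a} → Prime p → Invertible p a → p ∤ a
prime∤invertible pp a-inv p∣a =
  contradiction (subst Prime (∣1⇒≡1 (invertible-∣⇒∣1 a-inv p∣a)) pp) ¬prime[1]

^≡1⇒invertible : ∀ {m a} e → .{{_ : NonZero e}} → a ^ e ≡ 1 [mod m ] → Invertible m a
^≡1⇒invertible {a = a} e aᵉ≡1 =
  invertible (a ^ pred e) (subst (_≡ 1 [mod _ ]) (cong (a ^_) (sym (suc-pred e))) aᵉ≡1)

HasOrder : ℕ → ℕ → ℕ → Set
HasOrder m a e = ∀ k → a ^ k ≡ 1 [mod m ] ⇔ e ∣ k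

^-*-≡1-mod : ∀ {m a σ} j → a ^ σ ≡ 1 [mod m ] → a ^ (j * σ) ≡ 1 [mod m ]
^-*-≡1-mod {m} {a} {σ} j aᵠ≡1 = begin
  a ^ (j * σ)    ≡⟨ cong (a ^_) (*-comm j σ) ⟩
  a ^ (σ * j)    ≡⟨ ^-*-assoc a σ j ⟨
  (a ^ σ) ^ j    ≈⟨ ^-cong-mod j aᵠ≡1 ⟩
  1 ^ j          ≡⟨ ^-zeroˡ j ⟩
  1              ∎
  where open ≡-mod-Reasoning m

minimal⇒hasOrder : ∀ {m a σ} → .{{_ : NonZero σ}} → a ^ σ ≡ 1 [mod m ] →
  (∀ s → 0 < s → s < σ → ¬ a ^ s ≡ 1 [mod m ]) → HasOrder m a σ
minimal⇒hasOrder {m} {a} {σ} aᵠ≡1 minimal k = mk⇔ to from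
  where
  from : σ ∣ k → a ^ k ≡ 1 [mod m ]
  from (divides j refl) = ^-*-≡1-mod j aᵠ≡1
  to : a ^ k ≡ 1 [mod m ] → σ ∣ k
  to aᵏ≡1 with k % σ ≟ 0
  ... | yes k%σ≡0 = m%n≡0⇒n∣m k σ k%σ≡0
  ... | no  k%σ≢0 = contradiction aʳ≡1 (minimal (k % σ) (n≢0⇒n>0 k%σ≢0) (m%n<n k σ))
    where
    aʳ≡1 : a ^ (k % σ) ≡ 1 [mod m ]
    aʳ≡1 = begin
      a ^ (k % σ)                      ≡⟨ *-identityʳ _ ⟨
      a ^ (k % σ) * 1                  ≈⟨ *-congˡ-mod (a ^ (k % σ)) (^-*-≡1-mod (k / σ) aᵠ≡1) ⟨
      a ^ (k % σ) * a ^ (k / σ * σ)    ≡⟨ ^-distribˡ-+-* a (k % σ) _ ⟨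
      a ^ (k % σ + k / σ * σ)          ≡⟨ cong (a ^_) (m≡m%n+[m/n]*n k σ) ⟨
      a ^ k                            ≈⟨ aᵏ≡1 ⟩
      1                                ∎
      where open ≡-mod-Reasoning m

hasOrder⇒minimal : ∀ {m a σ} → HasOrder m a σ → ∀ s → 0 < s → s < σ → ¬ a ^ s ≡ 1 [mod m ]
hasOrder⇒minimal order s 0<s s<σ aˢ≡1 = <⇒≱ s<σ (∣⇒≤ {{>-nonZero 0<s}} (Equivalence.to (order s) aˢ≡1))

^-cong-order : ∀ {m a σ} → HasOrder m a σ → ∀ {i j} → i ≡ j [mod σ ] → a ^ i ≡ a ^ j [mod m ]
^-cong-order {m} {a} {σ} order {i} {j} (congruent k l i+kσ≡j+lσ) = begin
  a ^ i                ≈⟨ ^-+-*σ i k ⟨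
  a ^ (i + k * σ)      ≡⟨ cong (a ^_) i+kσ≡j+lσ ⟩
  a ^ (j + l * σ)      ≈⟨ ^-+-*σ j l ⟩
  a ^ j                ∎
  where
  open ≡-mod-Reasoning m
  ^-+-*σ : ∀ i k → a ^ (i + k * σ) ≡ a ^ i [mod m ]
  ^-+-*σ i k = begin
    a ^ (i + k * σ)      ≡⟨ ^-distribˡ-+-* a i (k * σ) ⟩
    a ^ i * a ^ (k * σ)  ≈⟨ *-congˡ-mod (a ^ i) (Equivalence.from (order (k * σ)) (n∣m*n k)) ⟩
    a ^ i * 1            ≡⟨ *-identityʳ _ ⟩
    a ^ i                ∎

^-cancel-order : ∀ {m a σ} → HasOrder m a σ → Invertible m a →
  ∀ {i j} → a ^ i ≡ a ^ j [mod m ] → i ≡ j [mod σ ]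
^-cancel-order {m} {a} {σ} order a-inv {i} {j} aⁱ≡aʲ =
  [ (λ i≤j → ≤-case i≤j aⁱ≡aʲ) , (λ j≤i → mod-sym (≤-case j≤i (mod-sym aⁱ≡aʲ))) ]′ (≤-total i j)
  where
  +-case : ∀ i d → a ^ i ≡ a ^ (i + d) [mod m ] → i ≡ i + d [mod σ ]
  +-case i d aⁱ≡aⁱ⁺ᵈ = mod-sym (∣⇒+-≡-mod i (Equivalence.to (order d) aᵈ≡1))
    where
    aᵈ≡1 : a ^ d ≡ 1 [mod m ]
    aᵈ≡1 = mod-sym (*-cancelˡ-mod {c = a ^ i} {1} {a ^ d} (^-invertible {a = a} i a-inv)
      (subst₂ _≡_[mod m ] (sym (*-identityʳ (a ^ i))) (^-distribˡ-+-* a i d) aⁱ≡aⁱ⁺ᵈ))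
  ≤-case : ∀ {i j} → i ≤ j → a ^ i ≡ a ^ j [mod m ] → i ≡ j [mod σ ]
  ≤-case {i} {j} i≤j =
    subst (λ j → a ^ i ≡ a ^ j [mod m ] → i ≡ j [mod σ ]) (m+[n∸m]≡n i≤j) (+-case i (j ∸ i))


prime∣prime⇒≡ : ∀ {p q} → Prime p → Prime q → p ∣ q → p ≡ q
prime∣prime⇒≡ pp pq p∣q with prime⇒irreducible pq p∣q
... | inj₁ refl = contradiction pp ¬prime[1]
... | inj₂ p≡q = p≡q

geomSum : ℕ → ℕ → ℕ
geomSum x zero    = 0
geomSum x (suc k) = 1 + suc x * geomSum x k

triangular : ℕ → ℕ
triangular zero    = 0
triangular (suc k) = k + triangular k

suc-^-geomSum : ∀ x k → suc x ^ k ≡ 1 + x * geomSum x k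
suc-^-geomSum x zero    = cong suc (sym (*-zeroʳ x))
suc-^-geomSum x (suc k) = begin
  suc x * suc x ^ k              ≡⟨ cong (suc x *_) (suc-^-geomSum x k) ⟩
  suc x * (1 + x * geomSum x k)  ≡⟨ ring x (geomSum x k) ⟩
  1 + x * geomSum x (suc k)      ∎
  where
  open ≡-Reasoning
  ring : ∀ x G → suc x * (1 + x * G) ≡ 1 + x * (1 + suc x * G)
  ring = solve-∀

geomSum-≡-mod : ∀ x k → geomSum x k ≡ k [mod x ]
geomSum-≡-mod x zero    = mod-refl
geomSum-≡-mod x (suc k) = begin
  1 + suc x * geomSum x k  ≈⟨ +-cong-mod (mod-refl {a = 1}) (*-congˡ-mod (suc x) (geomSum-≡-mod x k)) ⟩
  1 + suc x * k            ≡⟨ solve (x ∷ k ∷ []) ⟩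
  suc k + k * x            ≈⟨ +-*-mod (suc k) k ⟩
  suc k                    ∎
  where open ≡-mod-Reasoning x

geomSum-≡-mod-square : ∀ x k → geomSum x k ≡ k + x * triangular k [mod x * x ]
geomSum-≡-mod-square x zero    = ≡⇒≡-mod (sym (cong (0 +_) (*-zeroʳ x)))
geomSum-≡-mod-square x (suc k) = begin
  1 + suc x * geomSum x k                          ≈⟨ +-cong-mod (mod-refl {a = 1})
                                                        (*-congˡ-mod (suc x) (geomSum-≡-mod-square x k)) ⟩
  1 + suc x * (k + x * triangular k)               ≡⟨ ring x k (triangular k) ⟩
  suc k + x * triangular (suc k) + triangular k * (x * x)  ≈⟨ +-*-mod _ (triangular k) ⟩
  suc k + x * triangular (suc k)                   ∎
  where
  open ≡-mod-Reasoning (x * x)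
  ring : ∀ x k T → 1 + suc x * (k + x * T) ≡ suc k + x * (k + T) + T * (x * x)
  ring = solve-∀

triangular-double : ∀ k → triangular k * 2 + k ≡ k * k
triangular-double zero    = refl
triangular-double (suc k) = begin
  (k + triangular k) * 2 + suc k      ≡⟨ ring k (triangular k) ⟩
  suc k + k + (triangular k * 2 + k)  ≡⟨ cong (suc k + k +_) (triangular-double k) ⟩
  suc k + k + k * k                   ≡⟨ solve (k ∷ []) ⟩
  suc k * suc k                       ∎
  where
  open ≡-Reasoning
  ring : ∀ k T → (k + T) * 2 + suc k ≡ suc k + k + (T * 2 + k)
  ring = solve-∀

prime∣triangular : ∀ {p} → Prime p → p ≢ 2 → p ∣ triangular p
prime∣triangular {p} pp p≢2 =
  [ id , (λ p∣2 → contradiction (prime∣prime⇒≡ pp prime[2] p∣2) p≢2) ]′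
    (euclidsLemma (triangular p) 2 pp p∣T*2)
  where
  p∣T*2 : p ∣ triangular p * 2
  p∣T*2 = ∣m+n∣m⇒∣n (subst (p ∣_) (sym (trans (+-comm p _) (triangular-double p))) (m∣m*n p)) ∣-refl

ExactDivisor : ℕ → ℕ → ℕ → Set
ExactDivisor r a x = a ∣ x × r * a ∤ x

*-exactDivisor : ∀ {r a b x y} → Prime r → .{{_ : NonZero a}} → .{{_ : NonZero b}} →
  ExactDivisor r a x → ExactDivisor r b y → ExactDivisor r (a * b) (x * y)
*-exactDivisor {r} {a} {b} pr (divides c refl , ra∤ca) (divides s refl , rb∤sb) =
  *-pres-∣ (n∣m*n c) (n∣m*n s) , rab∤casb
  where
  instance _ = m*n≢0 a b
  rab∤casb : r * (a * b) ∤ c * a * (s * b)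
  rab∤casb rab∣casb with euclidsLemma c s pr
    (*-cancelʳ-∣ (a * b) (subst (r * (a * b) ∣_) ([m*n]*[o*p]≡[m*o]*[n*p] c a s b) rab∣casb))
  ... | inj₁ r∣c = ra∤ca (*-monoˡ-∣ a r∣c)
  ... | inj₂ r∣s = rb∤sb (*-monoˡ-∣ b r∣s)

exactDivisor-*-∤ : ∀ {r a x y} → Prime r → .{{_ : NonZero a}} →
  ExactDivisor r a x → r ∤ y → ExactDivisor r a (x * y)
exactDivisor-*-∤ {r} {a} {x} {y} pr a-exact r∤y = subst (λ a → ExactDivisor r a (x * y)) (*-identityʳ a)
  (*-exactDivisor pr a-exact (1∣ y , λ r*1∣y → r∤y (subst (_∣ y) (*-identityʳ r) r*1∣y)))

prime∤geomSum : ∀ {r p x} → Prime r → Prime p → r ≢ p → r ∣ x → r ∤ geomSum x p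
prime∤geomSum pr pp r≢p r∣x r∣G = r≢p (prime∣prime⇒≡ pr pp (∣-resp-mod r∣x (geomSum-≡-mod _ _) r∣G))

prime∣geomSum : ∀ {p x} → p ∣ x → p ∣ geomSum x p
prime∣geomSum p∣x = ∣-resp-mod p∣x (mod-sym (geomSum-≡-mod _ _)) ∣-refl

-- Lifting the exponent: ((1 + x)^p − 1) / x is divisible by p exactly once.
exactDivisor-geomSum : ∀ {p x} → Prime p → p ∣ x → (p ≡ 2 → 4 ∣ x) → ExactDivisor p p (geomSum x p)
exactDivisor-geomSum {p} {x} pp p∣x p≡2⇒4∣x = prime∣geomSum p∣x , p²∤G
  where
  instance _ = prime⇒nonZero pp
  p²∣xT : p * p ∣ x * triangular p
  p²∣xT with p ≟ 2
  ... | yes refl = subst (4 ∣_) (sym (*-identityʳ x)) (p≡2⇒4∣x refl)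
  ... | no p≢2   = *-pres-∣ p∣x (prime∣triangular pp p≢2)
  G≡p : geomSum x p ≡ p [mod p * p ]
  G≡p = mod-trans (mod-∣-weaken (*-pres-∣ p∣x p∣x) (geomSum-≡-mod-square x p))
          (subst (_≡ p [mod p * p ]) (+-comm _ p) (+-cong-mod (∣⇒≡0-mod p²∣xT) (mod-refl {a = p})))
  p²∤G : p * p ∤ geomSum x p
  p²∤G p²∣G =
    <⇒≱ (m<m*n p p (nonTrivial⇒n>1 p {{prime⇒nonTrivial pp}})) (∣⇒≤ (∣-resp-mod ∣-refl G≡p p²∣G))

suc-^-≡1+* : ∀ {D x} → D ∣ x → ∀ k → ∃[ y ] suc x ^ k ≡ 1 + D * y
suc-^-≡1+* {D} {x} (divides c refl) k = c * geomSum x k , (begin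
  suc x ^ k                 ≡⟨ suc-^-geomSum x k ⟩
  1 + c * D * geomSum x k   ≡⟨ cong suc (xy∙z≈y∙xz c D (geomSum x k)) ⟩
  1 + D * (c * geomSum x k) ∎)
  where open ≡-Reasoning

suc-^-≡1-mod : ∀ {D x} k → D ∣ x → suc x ^ k ≡ 1 [mod D ]
suc-^-≡1-mod {x = x} k D∣x = subst (suc x ^ k ≡_[mod _ ]) (^-zeroˡ k) (^-cong-mod k (∣⇒≡1-mod D∣x))

≡1-mod⇒≡1+* : ∀ {D e z} → .{{_ : NonZero e}} → z ≡ 1 [mod D ] → ∃[ y ] z ≡ 1 + D * y [mod D * e ]
≡1-mod⇒≡1+* {D} {e} {z} (congruent k l eq) = l + k * pred e , congruent k 0 (begin
  z + k * (D * e)                   ≡⟨ cong (λ e → z + k * (D * e)) (suc-pred e) ⟨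
  z + k * (D * suc (pred e))        ≡⟨ ring z k D (pred e) ⟩
  z + k * D + D * (k * pred e)      ≡⟨ cong (_+ D * (k * pred e)) eq ⟩
  1 + l * D + D * (k * pred e)      ≡⟨ ring′ l D k (pred e) ⟩
  1 + D * (l + k * pred e) + 0      ∎)
  where
  open ≡-Reasoning
  ring : ∀ z k D e → z + k * (D * suc e) ≡ z + k * D + D * (k * e)
  ring = solve-∀
  ring′ : ∀ l D k e → 1 + l * D + D * (k * e) ≡ 1 + D * (l + k * e) + 0
  ring′ = solve-∀

-- Conditions under which 1 + x generates the subgroup 1 + Dℤ of (ℤ/Deℤ)ˣ, of order e.
record GeneratorConditions (x D e : ℕ) : Set where
  field
    D∣x   : D ∣ x
    exact : ∀ {r} → Prime r → r ∣ e → r ∣ D × r * D ∤ x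
    8∣⇒4∣ : 8 ∣ D * e → 4 ∣ x

module _ {p x D e} (pp : Prime p) .{{_ : NonZero D}} (cond : GeneratorConditions x D (p * e)) where
  open GeneratorConditions cond

  private
    p∣D : p ∣ D
    p∣D = proj₁ (exact pp (m∣m*n e))

    p∣x : p ∣ x
    p∣x = ∣-trans p∣D D∣x

  generatorConditions-step : GeneratorConditions (x * geomSum x p) (p * D) e
  generatorConditions-step = record
    { D∣x   = subst (p * D ∣_) (*-comm (geomSum x p) x) (*-pres-∣ (prime∣geomSum p∣x) D∣x)
    ; exact = exact′
    ; 8∣⇒4∣ = λ 8∣pDe → ∣m⇒∣m*n (geomSum x p) (8∣⇒4∣ (subst (8 ∣_) (xy∙z≈y∙xz p D e) 8∣pDe))
    }
    where
    exact′ : ∀ {r} → Prime r → r ∣ e → r ∣ p * D × r * (p * D) ∤ x * geomSum x p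
    exact′ {r} pr r∣e with exact pr (∣n⇒∣m*n p r∣e) | r ≟ p
    ... | r∣D , rD∤x | yes refl = ∣n⇒∣m*n r r∣D , subst (λ a → r * a ∤ x * geomSum x r) (*-comm D r)
          (proj₂ (*-exactDivisor pr (D∣x , rD∤x) (exactDivisor-geomSum pp p∣x p≡2⇒4∣x)))
      where
      instance _ = prime⇒nonZero pp
      p≡2⇒4∣x : r ≡ 2 → 4 ∣ x
      p≡2⇒4∣x refl = 8∣⇒4∣ (*-pres-∣ r∣D (*-monoʳ-∣ 2 r∣e))
    ... | r∣D , rD∤x | no r≢p =
      ∣n⇒∣m*n p r∣D , λ rpD∣xG → proj₂ rD-exact (∣-trans (*-monoʳ-∣ r (n∣m*n p)) rpD∣xG)
      where
      rD-exact : ExactDivisor r D (x * geomSum x p)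
      rD-exact = exactDivisor-*-∤ pr (D∣x , rD∤x) (prime∤geomSum pr pp r≢p (∣-trans r∣D D∣x))

suc-^≡1⇒prime∣exponent : ∀ {p D x k} → Prime p → .{{_ : NonZero D}} → p ∣ x → D ∣ x → p * D ∤ x →
  suc x ^ k ≡ 1 [mod p * D ] → p ∣ k
suc-^≡1⇒prime∣exponent {p} {D} {x} {k} pp p∣x D∣x pD∤x aᵏ≡1 with p ∣? geomSum x k
... | yes p∣G = ∣-resp-mod p∣x (geomSum-≡-mod x k) p∣G
... | no p∤G = contradiction pD∣xG (proj₂ (exactDivisor-*-∤ pp (D∣x , pD∤x) p∤G))
  where
  pD∣xG : p * D ∣ x * geomSum x k
  pD∣xG = ≡1-mod⇒∣ (subst (_≡ 1 [mod p * D ]) (suc-^-geomSum x k) aᵏ≡1)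

-- (1 + cD)ʲ ≡ 1 + jcD (mod pD), and c is invertible modulo p.
suc-^-onto-mod-pD : ∀ {p D x} → Prime p → p ∣ x → D ∣ x → p * D ∤ x →
  ∀ y → ∃[ j ] suc x ^ j ≡ 1 + D * y [mod p * D ]
suc-^-onto-mod-pD {p} {D} pp p∣x (divides c refl) pD∤x y = w * y , aʷʸ≡1+Dy
  where
  p∤c : p ∤ c
  p∤c p∣c = pD∤x (*-monoˡ-∣ D p∣c)
  open Invertible (prime∤⇒invertible pp p∤c) renaming (inverse to w; *-inverse to cw≡1)
  G = geomSum (c * D) (w * y)

  cG≡y : c * G ≡ y [mod p ]
  cG≡y = begin
    c * G        ≈⟨ *-congˡ-mod c (mod-∣-weaken p∣x (geomSum-≡-mod (c * D) (w * y))) ⟩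
    c * (w * y)  ≡⟨ *-assoc c w y ⟨
    c * w * y    ≈⟨ *-congʳ-mod y cw≡1 ⟩
    1 * y        ≡⟨ *-identityˡ y ⟩
    y            ∎
    where open ≡-mod-Reasoning p

  aʷʸ≡1+Dy : suc (c * D) ^ (w * y) ≡ 1 + D * y [mod p * D ]
  aʷʸ≡1+Dy = begin
    suc (c * D) ^ (w * y)  ≡⟨ suc-^-geomSum (c * D) (w * y) ⟩
    1 + c * D * G          ≡⟨ cong suc (xy∙z≈y∙xz c D G) ⟩
    1 + D * (c * G)        ≈⟨ +-cong-mod (mod-refl {a = 1})
                                (subst (D * (c * G) ≡ D * y [mod_]) (*-comm D p) (*-scale-mod D cG≡y)) ⟩
    1 + D * y              ∎
    where open ≡-mod-Reasoning (p * D)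

generator-hasOrder′ : ∀ {ps} → All Prime ps → ∀ {x D} → .{{_ : NonZero D}} →
  GeneratorConditions x D (product ps) → HasOrder (D * product ps) (suc x) (product ps)
generator-hasOrder′ All.[] {x} {D} cond k =
  mk⇔ (λ _ → 1∣ k)
      (λ _ → suc-^-≡1-mod k (subst (_∣ x) (sym (*-identityʳ D)) (GeneratorConditions.D∣x cond)))
generator-hasOrder′ {p ∷ ps} (pp All.∷ pps) {x} {D} cond k = mk⇔ to from
  where
  open GeneratorConditions cond
  instance
    _ = prime⇒nonZero pp
    _ = m*n≢0 p D
  e = product ps
  p∣D = proj₁ (exact pp (m∣m*n e))
  M≡ = xy∙z≈y∙xz p D e
  IH : HasOrder (p * D * e) (suc (x * geomSum x p)) e
  IH = generator-hasOrder′ pps (generatorConditions-step pp cond)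
  ^-p* : ∀ j → suc x ^ (p * j) ≡ suc (x * geomSum x p) ^ j
  ^-p* j = trans (sym (^-*-assoc (suc x) p j)) (cong (_^ j) (suc-^-geomSum x p))
  to : suc x ^ k ≡ 1 [mod D * (p * e) ] → p * e ∣ k
  to aᵏ≡1 with suc-^≡1⇒prime∣exponent {k = k} pp (∣-trans p∣D D∣x) D∣x (proj₂ (exact pp (m∣m*n e)))
                 (mod-∣-weaken (subst (p * D ∣_) M≡ (m∣m*n e)) aᵏ≡1)
  ... | divides j refl = subst (p * e ∣_) (*-comm p j) (*-monoʳ-∣ p (Equivalence.to (IH j) aᵖʲ≡1))
    where
    aᵖʲ≡1 : suc (x * geomSum x p) ^ j ≡ 1 [mod p * D * e ]
    aᵖʲ≡1 = subst₂ (λ M a → a ≡ 1 [mod M ]) (sym M≡) (trans (cong (suc x ^_) (*-comm j p)) (^-p* j)) aᵏ≡1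
  from : p * e ∣ k → suc x ^ k ≡ 1 [mod D * (p * e) ]
  from (divides j refl) =
    subst₂ (λ M a → a ≡ 1 [mod M ]) M≡ (trans (sym (^-p* (j * e))) (cong (suc x ^_) (x∙yz≈y∙xz p j e)))
      (Equivalence.from (IH (j * e)) (n∣m*n j))

-- Reach 1 + Dy modulo pD first; the remaining error lies in 1 + pDℤ, which the
-- powers of (1 + x)^p cover by induction.
generator-onto′ : ∀ {ps} → All Prime ps → ∀ {x D} → .{{_ : NonZero D}} →
  GeneratorConditions x D (product ps) → ∀ y → ∃[ k ] suc x ^ k ≡ 1 + D * y [mod D * product ps ]
generator-onto′ All.[] {D = D} cond y = 0 , mod-sym (∣⇒≡1-mod (*-monoʳ-∣ D (1∣ y)))
generator-onto′ {p ∷ ps} (pp All.∷ pps) {x} {D} cond y = j + p * k′ , aʲ⁺ᵖᵏ′≡1+Dy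
  where
  open GeneratorConditions cond
  instance
    _ = prime⇒nonZero pp
    _ = m*n≢0 p D
    _ = productOfPrimes≢0 pps
    _ = productOfPrimes≢0 (pp All.∷ pps)
  e = product ps
  M≡ = xy∙z≈y∙xz p D e
  p∣D = proj₁ (exact pp (m∣m*n e))
  pD∣M = subst (p * D ∣_) M≡ (m∣m*n e)
  a = suc x
  x′ = x * geomSum x p
  ^-p* : ∀ j → a ^ (p * j) ≡ suc x′ ^ j
  ^-p* j = trans (sym (^-*-assoc (suc x) p j)) (cong (_^ j) (suc-^-geomSum x p))

  j = proj₁ (suc-^-onto-mod-pD pp (∣-trans p∣D D∣x) D∣x (proj₂ (exact pp (m∣m*n e))) y)
  aʲ≡1+Dy : a ^ j ≡ 1 + D * y [mod p * D ]
  aʲ≡1+Dy = proj₂ (suc-^-onto-mod-pD pp (∣-trans p∣D D∣x) D∣x (proj₂ (exact pp (m∣m*n e))) y)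

  aʲ-invertible : Invertible (D * (p * e)) (a ^ j)
  aʲ-invertible = ^-invertible j (^≡1⇒invertible (p * e)
    (Equivalence.from (generator-hasOrder′ (pp All.∷ pps) cond (p * e)) ∣-refl))
  open Invertible aʲ-invertible renaming (inverse to v; *-inverse to aʲv≡1)
  Z = v * (1 + D * y)
  Z≡1 : Z ≡ 1 [mod p * D ]
  Z≡1 = begin
    v * (1 + D * y)  ≈⟨ *-congˡ-mod v aʲ≡1+Dy ⟨
    v * a ^ j        ≡⟨ *-comm v (a ^ j) ⟩
    a ^ j * v        ≈⟨ mod-∣-weaken pD∣M aʲv≡1 ⟩
    1                ∎
    where open ≡-mod-Reasoning (p * D)
  y′ = proj₁ (≡1-mod⇒≡1+* {e = e} Z≡1)
  Z≡1+pDy′ : Z ≡ 1 + p * D * y′ [mod p * D * e ]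
  Z≡1+pDy′ = proj₂ (≡1-mod⇒≡1+* {e = e} Z≡1)
  IH = generator-onto′ pps (generatorConditions-step pp cond) y′
  k′ = proj₁ IH
  aᵖᵏ′≡Z : a ^ (p * k′) ≡ Z [mod D * (p * e) ]
  aᵖᵏ′≡Z =
    subst₂ (λ M b → b ≡ Z [mod M ]) M≡ (sym (^-p* k′)) (mod-trans (proj₂ IH) (mod-sym Z≡1+pDy′))
  aʲ⁺ᵖᵏ′≡1+Dy : a ^ (j + p * k′) ≡ 1 + D * y [mod D * (p * e) ]
  aʲ⁺ᵖᵏ′≡1+Dy = begin
    a ^ (j + p * k′)         ≡⟨ ^-distribˡ-+-* a j (p * k′) ⟩
    a ^ j * a ^ (p * k′)     ≈⟨ *-congˡ-mod (a ^ j) aᵖᵏ′≡Z ⟩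
    a ^ j * (v * (1 + D * y)) ≡⟨ *-assoc (a ^ j) v _ ⟨
    a ^ j * v * (1 + D * y)  ≈⟨ *-congʳ-mod (1 + D * y) aʲv≡1 ⟩
    1 * (1 + D * y)          ≡⟨ *-identityˡ _ ⟩
    1 + D * y                ∎
    where open ≡-mod-Reasoning (D * (p * e))

module _ {x D e} .{{_ : NonZero D}} .{{_ : NonZero e}} (cond : GeneratorConditions x D e) where
  private
    module F = PrimeFactorisation (factorise e)
    cond′ : GeneratorConditions x D (product F.factors)
    cond′ = subst (GeneratorConditions x D) F.isFactorisation cond

  generator-hasOrder : HasOrder (D * e) (suc x) e
  generator-hasOrder = subst (λ e → HasOrder (D * e) (suc x) e) (sym F.isFactorisation)
    (generator-hasOrder′ F.factorsPrime cond′)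

  generator-onto : ∀ y → ∃[ k ] suc x ^ k ≡ 1 + D * y [mod D * e ]
  generator-onto = subst (λ e → ∀ y → ∃[ k ] suc x ^ k ≡ 1 + D * y [mod D * e ]) (sym F.isFactorisation)
    (generator-onto′ F.factorsPrime cond′)

radFactor : ℕ → ℕ → ℕ
radFactor m p = if ⌊ prime? p ⌋ ∧ ⌊ p ∣? m ⌋ then p else 1

radBelow : ℕ → ℕ → ℕ
radBelow m k = product (map (radFactor m) (upTo k))

radBelow-suc : ∀ m k → radBelow m (suc k) ≡ radBelow m k * radFactor m k
radBelow-suc m k = begin
  product (map (radFactor m) (upTo (suc k)))          ≡⟨ cong (product ∘′ map (radFactor m)) (upTo-∷ʳ k) ⟨
  product (map (radFactor m) (upTo k ∷ʳ k))           ≡⟨ cong product (map-++ (radFactor m) (upTo k) [ k ]) ⟩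
  product (map (radFactor m) (upTo k) ∷ʳ radFactor m k) ≡⟨ product-++ (map (radFactor m) (upTo k)) [ radFactor m k ] ⟩
  radBelow m k * (radFactor m k * 1)                  ≡⟨ cong (radBelow m k *_) (*-identityʳ (radFactor m k)) ⟩
  radBelow m k * radFactor m k                        ∎
  where open ≡-Reasoning

radFactor-cases : ∀ m p →
  (Prime p × p ∣ m × radFactor m p ≡ p) ⊎ (¬ (Prime p × p ∣ m) × radFactor m p ≡ 1)
radFactor-cases m p with prime? p | p ∣? m
... | yes pp | yes p∣m = inj₁ (pp , p∣m , refl)
... | yes _  | no  p∤m = inj₂ (p∤m ∘′ proj₂ , refl)
... | no  ¬pp | _      = inj₂ (¬pp ∘′ proj₁ , refl)

prime∣radBelow : ∀ {m p} k → Prime p → p ∣ m → p < k → p ∣ radBelow m k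
prime∣radBelow {m} {p} (suc k) pp p∣m p<1+k with m≤n⇒m<n∨m≡n (≤-pred p<1+k)
... | inj₁ p<k = subst (p ∣_) (sym (radBelow-suc m k)) (∣m⇒∣m*n _ (prime∣radBelow k pp p∣m p<k))
... | inj₂ refl with radFactor-cases m p
...   | inj₁ (_ , _ , f≡p) =
  subst (p ∣_) (sym (trans (radBelow-suc m p) (cong (radBelow m p *_) f≡p))) (n∣m*n (radBelow m p))
...   | inj₂ (¬pp×p∣m , _) = contradiction (pp , p∣m) ¬pp×p∣m

prime∣rad : ∀ {m p} → Prime p → p ∣ m → .{{_ : NonZero m}} → p ∣ rad m
prime∣rad {m} pp p∣m = prime∣radBelow (suc m) pp p∣m (s≤s (∣⇒≤ p∣m))

radBelow-∣ : ∀ {m X} → (∀ {p} → Prime p → p ∣ m → p ∣ X) → ∀ k →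
  radBelow m k ∣ X × (∀ {r} → Prime r → r ∣ radBelow m k → r < k)
radBelow-∣ {m} {X} primes∣X zero =
  1∣ X , λ pr r∣1 → contradiction (subst Prime (∣1⇒≡1 r∣1) pr) ¬prime[1]
radBelow-∣ {m} {X} primes∣X (suc k) with radBelow-∣ primes∣X k | radFactor-cases m k
... | R∣X , R-small | inj₂ (_ , f≡1) =
  subst (_∣ X) (sym R′≡R) R∣X , λ {r} pr r∣R′ → m≤n⇒m≤1+n (R-small pr (subst (r ∣_) R′≡R r∣R′))
  where
  R′≡R : radBelow m (suc k) ≡ radBelow m k
  R′≡R = trans (radBelow-suc m k) (trans (cong (radBelow m k *_) f≡1) (*-identityʳ _))
... | divides z X≡zR , R-small | inj₁ (pk , k∣m , f≡k) = subst (_∣ X) (sym R′≡Rk) Rk∣X , R′-small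
  where
  R = radBelow m k
  R′≡Rk : radBelow m (suc k) ≡ R * k
  R′≡Rk = trans (radBelow-suc m k) (cong (R *_) f≡k)
  Rk∣X : R * k ∣ X
  Rk∣X with euclidsLemma z R pk (subst (k ∣_) X≡zR (primes∣X pk k∣m))
  ... | inj₂ k∣R = contradiction (R-small pk k∣R) (<-irrefl refl)
  ... | inj₁ (divides w z≡wk) = divides w (trans X≡zR (trans (cong (_* R) z≡wk) (xy∙z≈x∙zy w k R)))
  R′-small : ∀ {r} → Prime r → r ∣ radBelow m (suc k) → r < suc k
  R′-small {r} pr r∣R′ with euclidsLemma R k pr (subst (r ∣_) R′≡Rk r∣R′)
  ... | inj₁ r∣R = m≤n⇒m≤1+n (R-small pr r∣R)
  ... | inj₂ r∣k = s≤s (∣⇒≤ {{prime⇒nonZero pk}} r∣k)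

rad-∣ : ∀ {m X} → (∀ {p} → Prime p → p ∣ m → p ∣ X) → rad m ∣ X
rad-∣ {m} primes∣X = proj₁ (radBelow-∣ primes∣X (suc m))

module _ {n g m β v} .{{_ : NonZero g}} (n≡gm : n ≡ g * m) (β≡gv : β ≡ g * v [mod n ])
         (v-inv : Invertible m v) where

  private
    β*≡g*v* : ∀ a → β * a ≡ g * (v * a) [mod n ]
    β*≡g*v* a = subst (β * a ≡_[mod n ]) (*-assoc g v a) (*-congʳ-mod a β≡gv)

  β*-cong-mod⇔ : ∀ {a b} → β * a ≡ β * b [mod n ] ⇔ a ≡ b [mod m ]
  β*-cong-mod⇔ {a} {b} = mk⇔ to from
    where
    to : β * a ≡ β * b [mod n ] → a ≡ b [mod m ]
    to βa≡βb = *-cancelˡ-mod v-inv (*-unscale-mod g (subst (λ n → g * (v * a) ≡ g * (v * b) [mod n ]) n≡gm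
      (mod-trans (mod-sym (β*≡g*v* a)) (mod-trans βa≡βb (β*≡g*v* b)))))
    from : a ≡ b [mod m ] → β * a ≡ β * b [mod n ]
    from a≡b = mod-trans (β*≡g*v* a) (mod-trans
      (subst (λ n → g * (v * a) ≡ g * (v * b) [mod n ]) (sym n≡gm) (*-scale-mod g (*-congˡ-mod v a≡b)))
      (mod-sym (β*≡g*v* b)))

  fixes⇔≡1-mod : .{{_ : NonZero n}} → ∀ a → (β * a) % n ≡ β % n ⇔ (a ≡ 1 [mod m ])
  fixes⇔≡1-mod a = mk⇔
    (λ βa≡β → Equivalence.to β*-cong-mod⇔
                (subst (β * a ≡_[mod n ]) (sym (*-identityʳ β)) (%≡⇒≡-mod βa≡β)))
    (λ a≡1 → trans (≡-mod⇒%≡ (Equivalence.from β*-cong-mod⇔ a≡1)) (cong (_% n) (*-identityʳ β)))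

  isOrder⇒hasOrder : .{{_ : NonZero n}} → ∀ {N σ} → IsOrder n N β σ → HasOrder m N σ
  isOrder⇒hasOrder {N} {σ} (0<σ , βNᵠ≡β , minimal) = minimal⇒hasOrder {{>-nonZero 0<σ}}
    (Equivalence.to (fixes⇔≡1-mod (N ^ σ)) βNᵠ≡β)
    (λ s 0<s s<σ Nˢ≡1 → minimal s 0<s s<σ (Equivalence.from (fixes⇔≡1-mod (N ^ s)) Nˢ≡1))

  hasOrder⇒isOrder : .{{_ : NonZero n}} → ∀ {N σ} → 0 < σ → HasOrder m N σ → IsOrder n N β σ
  hasOrder⇒isOrder {N} {σ} 0<σ order = 0<σ
    , Equivalence.from (fixes⇔≡1-mod (N ^ σ)) (Equivalence.from (order σ) ∣-refl)
    , λ s 0<s s<σ βNˢ≡β → hasOrder⇒minimal order s 0<s s<σ (Equivalence.to (fixes⇔≡1-mod (N ^ s)) βNˢ≡β)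

module _ {n g m D e β v Q} .{{_ : NonZero n}} .{{_ : NonZero g}} .{{_ : NonZero e}}
  (n≡gm : n ≡ g * m) (m≡De : m ≡ D * e) (β≡gv : β ≡ g * v [mod n ]) (v-inv : Invertible m v)
  (order : HasOrder m Q e)
  (powers : ∀ k → ∃[ y ] Q ^ k ≡ 1 + D * y [mod m ])
  (onto : ∀ y → ∃[ k ] Q ^ k ≡ 1 + D * y [mod m ]) where

  private
    n≡gDe : n ≡ g * D * e
    n≡gDe = trans n≡gm (trans (cong (g *_) m≡De) (sym (*-assoc g D e)))

    β[1+Dy]≡β+i[gD] : ∀ {y i} → v * y ≡ i [mod e ] → β * (1 + D * y) ≡ β + i * (g * D) [mod n ]
    β[1+Dy]≡β+i[gD] {y} {i} vy≡i = begin
      β * (1 + D * y)          ≡⟨ solve (β ∷ D ∷ y ∷ []) ⟩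
      β + β * (D * y)          ≈⟨ +-cong-mod (mod-refl {a = β}) (*-congʳ-mod (D * y) β≡gv) ⟩
      β + g * v * (D * y)      ≡⟨ cong (β +_) (solve (g ∷ v ∷ D ∷ y ∷ [])) ⟩
      β + (g * D) * (v * y)    ≈⟨ +-cong-mod (mod-refl {a = β})
                                    (subst ((g * D) * (v * y) ≡ (g * D) * i [mod_]) (sym n≡gDe) (*-scale-mod (g * D) vy≡i)) ⟩
      β + (g * D) * i          ≡⟨ cong (β +_) (*-comm (g * D) i) ⟩
      β + i * (g * D)          ∎
      where open ≡-mod-Reasoning n

    βQᵏ≡β[1+Dy] : ∀ k {y} → Q ^ k ≡ 1 + D * y [mod m ] → β * Q ^ k ≡ β * (1 + D * y) [mod n ]
    βQᵏ≡β[1+Dy] k = Equivalence.from (β*-cong-mod⇔ n≡gm β≡gv v-inv)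

    to : ∀ x → Coset n Q β x → ∃[ i ] (i < e × (β + i * (g * D)) % n ≡ x % n)
    to x (k , βQᵏ≡x) = (v * y) % e , m%n<n (v * y) e , trans (sym (≡-mod⇒%≡ βQᵏ≡β+i[gD])) βQᵏ≡x
      where
      y = proj₁ (powers k)
      βQᵏ≡β+i[gD] : β * Q ^ k ≡ β + (v * y) % e * (g * D) [mod n ]
      βQᵏ≡β+i[gD] = mod-trans (βQᵏ≡β[1+Dy] k (proj₂ (powers k))) (β[1+Dy]≡β+i[gD] (mod-sym (%-mod (v * y))))

    from : ∀ x → ∃[ i ] (i < e × (β + i * (g * D)) % n ≡ x % n) → Coset n Q β x
    from x (i , _ , β+i[gD]≡x) = k , trans (≡-mod⇒%≡ βQᵏ≡β+i[gD]) β+i[gD]≡x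
      where
      open Invertible v-inv renaming (inverse to w; *-inverse to vw≡1)
      k = proj₁ (onto (w * i))
      vwi≡i : v * (w * i) ≡ i [mod e ]
      vwi≡i = begin
        v * (w * i)  ≡⟨ *-assoc v w i ⟨
        v * w * i    ≈⟨ *-congʳ-mod i (mod-∣-weaken (subst (e ∣_) (sym m≡De) (n∣m*n D)) vw≡1) ⟩
        1 * i        ≡⟨ *-identityˡ i ⟩
        i            ∎
        where open ≡-mod-Reasoning e
      βQᵏ≡β+i[gD] : β * Q ^ k ≡ β + i * (g * D) [mod n ]
      βQᵏ≡β+i[gD] = mod-trans (βQᵏ≡β[1+Dy] k (proj₂ (onto (w * i)))) (β[1+Dy]≡β+i[gD] vwi≡i)

  generator⇒equalDiffCoset : EqualDiffCoset n Q β
  generator⇒equalDiffCoset = e , hasOrder⇒isOrder n≡gm β≡gv v-inv (>-nonZero⁻¹ e) order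
    , g * D , n≡gDe , λ x → mk⇔ (to x) (from x)

odd-square≡1-mod8 : ∀ h → (1 + h * 2) * (1 + h * 2) ≡ 1 [mod 8 ]
odd-square≡1-mod8 zero    = mod-refl
odd-square≡1-mod8 (suc h) = begin
  (1 + suc h * 2) * (1 + suc h * 2)         ≡⟨ ring h ⟩
  (1 + h * 2) * (1 + h * 2) + suc h * 8     ≈⟨ +-*-mod _ (suc h) ⟩
  (1 + h * 2) * (1 + h * 2)                 ≈⟨ odd-square≡1-mod8 h ⟩
  1                                         ∎
  where
  open ≡-mod-Reasoning 8
  ring : ∀ h → (1 + suc h * 2) * (1 + suc h * 2) ≡ (1 + h * 2) * (1 + h * 2) + suc h * 8
  ring = solve-∀

odd-^≡1⊎≡self-mod8 : ∀ h k → ((1 + h * 2) ^ k ≡ 1 [mod 8 ]) ⊎ ((1 + h * 2) ^ k ≡ 1 + h * 2 [mod 8 ])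
odd-^≡1⊎≡self-mod8 h zero = inj₁ mod-refl
odd-^≡1⊎≡self-mod8 h (suc k) with odd-^≡1⊎≡self-mod8 h k
... | inj₁ Qᵏ≡1 =
  inj₂ (subst ((1 + h * 2) ^ suc k ≡_[mod 8 ]) (*-identityʳ _) (*-congˡ-mod (1 + h * 2) Qᵏ≡1))
... | inj₂ Qᵏ≡Q = inj₁ (mod-trans (*-congˡ-mod (1 + h * 2) Qᵏ≡Q) (odd-square≡1-mod8 h))

odd-*-4∣⇒4∣ : ∀ {o s} → 2 ∤ o → 4 ∣ o * s → 4 ∣ s
odd-*-4∣⇒4∣ {o} {s} 2∤o 4∣os with euclidsLemma o s prime[2] (∣-trans (divides 2 refl) 4∣os)
... | inj₁ 2∣o = contradiction 2∣o 2∤o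
... | inj₂ (divides s′ refl)
    with euclidsLemma o s′ prime[2] (*-cancelʳ-∣ 2 (subst (4 ∣_) (sym (*-assoc o s′ 2)) 4∣os))
...   | inj₁ 2∣o = contradiction 2∣o 2∤o
...   | inj₂ 2∣s′ = *-monoˡ-∣ 2 2∣s′

8∣*⇒4∣ : ∀ {d σ} → 2 ∣ d → 4 ∤ d → 8 ∣ d * σ → 4 ∣ σ
8∣*⇒4∣ {σ = σ} (divides o refl) 4∤d 8∣dσ =
  odd-*-4∣⇒4∣ 2∤o (*-cancelˡ-∣ 2 (subst (8 ∣_) (xy∙z≈y∙xz o 2 σ) 8∣dσ))
  where
  2∤o : 2 ∤ o
  2∤o 2∣o = 4∤d (*-monoˡ-∣ 2 2∣o)

-- Modulo 8 the powers of an odd number take only the two values 1 and Q,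
-- so u·Qᵏ cannot reach both u + d′ and u + 2d′ unless 4 ∣ d′.
odd-powers-mod8⇒4∣ : ∀ {u h d′} → let Q = 1 + h * 2 in
  (∃[ k ] u * Q ^ k ≡ u + 1 * d′ [mod 8 ]) → (∃[ k ] u * Q ^ k ≡ u + 2 * d′ [mod 8 ]) → 4 ∣ d′
odd-powers-mod8⇒4∣ {u} {h} {d′} (k₁ , uQᵏ¹≡u+d′) (k₂ , uQᵏ²≡u+2d′) =
  [ (λ 8∣1d′ → 8∣d′⇒4∣d′ (subst (8 ∣_) (*-identityˡ d′) 8∣1d′))
  , (λ u+d′≡uQ → [ *-cancelˡ-∣ 2
                 , (λ u+2d′≡uQ → u+d′≡u+2d′⇒4∣d′ (mod-trans u+d′≡uQ (mod-sym u+2d′≡uQ)))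
                 ]′ (8∣jd′⊎u+jd′≡uQ {2} k₂ uQᵏ²≡u+2d′))
  ]′ (8∣jd′⊎u+jd′≡uQ {1} k₁ uQᵏ¹≡u+d′)
  where
  Q = 1 + h * 2

  8∣d′⇒4∣d′ : 8 ∣ d′ → 4 ∣ d′
  8∣d′⇒4∣d′ = ∣-trans (divides 2 refl)

  8∣jd′⊎u+jd′≡uQ : ∀ {j} k → u * Q ^ k ≡ u + j * d′ [mod 8 ] →
    (8 ∣ j * d′) ⊎ (u + j * d′ ≡ u * Q [mod 8 ])
  8∣jd′⊎u+jd′≡uQ {j} k uQᵏ≡u+jd′ =
    [ (λ Qᵏ≡1 → inj₁ (≡0-mod⇒∣ (+-cancelˡ-mod u (begin
        u + j * d′  ≈⟨ uQᵏ≡u+jd′ ⟨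
        u * Q ^ k   ≈⟨ *-congˡ-mod u Qᵏ≡1 ⟩
        u * 1       ≡⟨ *-identityʳ u ⟩
        u           ≡⟨ +-identityʳ u ⟨
        u + 0       ∎))))
    , (λ Qᵏ≡Q → inj₂ (mod-trans (mod-sym uQᵏ≡u+jd′) (*-congˡ-mod u Qᵏ≡Q)))
    ]′ (odd-^≡1⊎≡self-mod8 h k)
    where open ≡-mod-Reasoning 8

  u+d′≡u+2d′⇒4∣d′ : u + 1 * d′ ≡ u + 2 * d′ [mod 8 ] → 4 ∣ d′
  u+d′≡u+2d′⇒4∣d′ u+d′≡u+2d′ = 8∣d′⇒4∣d′ (≡0-mod⇒∣ (mod-sym (+-cancelˡ-mod (u + 1 * d′) (begin
    u + 1 * d′ + 0   ≡⟨ +-identityʳ _ ⟩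
    u + 1 * d′       ≈⟨ u+d′≡u+2d′ ⟩
    u + 2 * d′       ≡⟨ solve (u ∷ d′ ∷ []) ⟩
    u + 1 * d′ + d′  ∎))))
    where open ≡-mod-Reasoning 8

module _ {m u Q d′ σ} .{{_ : NonZero σ}} (m≡d′σ : m ≡ d′ * σ)
  (u-inv : Invertible m u) (Q-inv : Invertible m Q)
  (progression⊆powers : ∀ i → i < σ → ∃[ k ] u * Q ^ k ≡ u + i * d′ [mod m ])
  (uQ∈progression : ∃[ i ] u * Q ≡ u + i * d′ [mod m ]) where

  Q≡1-mod-common-divisor : ∀ {N} → N ∣ m → N ∣ d′ → Q ≡ 1 [mod N ]
  Q≡1-mod-common-divisor {N} N∣m N∣d′ = mod-sym (*-cancelˡ-mod (invertible-∣-weaken N∣m u-inv) (begin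
    u * 1                       ≡⟨ *-identityʳ u ⟩
    u                           ≈⟨ ∣⇒+-≡-mod u (∣n⇒∣m*n i N∣d′) ⟨
    u + i * d′                  ≈⟨ mod-∣-weaken N∣m (proj₂ uQ∈progression) ⟨
    u * Q                       ∎))
    where
    i = proj₁ uQ∈progression
    open ≡-mod-Reasoning N

  prime∣m⇒prime∣d′ : ∀ {p} → Prime p → p ∣ m → p ∣ d′
  prime∣m⇒prime∣d′ {p} pp p∣m with p ∣? d′
  ... | yes p∣d′ = p∣d′
  ... | no  p∤d′ = contradiction (∣-resp-mod p∣m (mod-sym uQᵏ≡u+id′) p∣u+id′)
                     (prime∤invertible pp (invertible-∣-weaken p∣m (*-invertible u-inv (^-invertible k Q-inv))))
    where
    instance _ = prime⇒nonZero pp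
    p∣σ : p ∣ σ
    p∣σ = [ (λ p∣d′ → contradiction p∣d′ p∤d′) , id ]′
            (euclidsLemma d′ σ pp (subst (p ∣_) m≡d′σ p∣m))
    open Invertible (prime∤⇒invertible pp p∤d′) renaming (inverse to w; *-inverse to d′w≡1)
    -- i ≡ -u/d′ (mod p)
    i = (pred p * u * w) % p
    k = proj₁ (progression⊆powers i (<-≤-trans (m%n<n _ p) (∣⇒≤ p∣σ)))
    uQᵏ≡u+id′ = proj₂ (progression⊆powers i (<-≤-trans (m%n<n _ p) (∣⇒≤ p∣σ)))
    p∣u+id′ : p ∣ u + i * d′
    p∣u+id′ = ≡0-mod⇒∣ (begin
      u + i * d′                     ≈⟨ +-cong-mod (mod-refl {a = u}) (*-congʳ-mod d′ (%-mod _)) ⟩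
      u + pred p * u * w * d′        ≡⟨ cong (u +_) (xy∙z≈x∙zy (pred p * u) w d′) ⟩
      u + pred p * u * (d′ * w)      ≈⟨ +-cong-mod (mod-refl {a = u}) (*-congˡ-mod (pred p * u) d′w≡1) ⟩
      u + pred p * u * 1             ≡⟨ cong (u +_) (*-identityʳ _) ⟩
      suc (pred p) * u               ≡⟨ cong (_* u) (suc-pred p) ⟩
      p * u                          ≈⟨ ∣⇒≡0-mod (m∣m*n u) ⟩
      0                              ∎)
      where open ≡-mod-Reasoning p

  rad∣Q∸1 : .{{_ : NonZero Q}} → rad m ∣ Q ∸ 1
  rad∣Q∸1 = rad-∣ (λ pp p∣m → ≡1-mod⇒∣∸1 (Q≡1-mod-common-divisor p∣m (prime∣m⇒prime∣d′ pp p∣m)))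

  8∣m⇒Q≡1-mod4 : .{{_ : NonZero Q}} → 8 ∣ m → Q % 4 ≡ 1
  8∣m⇒Q≡1-mod4 8∣m with 4 ∣? d′
  ... | yes 4∣d′ = ≡-mod⇒%≡ (Q≡1-mod-common-divisor (∣-trans (divides 2 refl) 8∣m) 4∣d′)
  ... | no  4∤d′ = contradiction
    (odd-powers-mod8⇒4∣ {u} {quotient 2∣Q∸1} (in-progression-mod8 1 1<σ) (in-progression-mod8 2 2<σ)) 4∤d′
    where
    2∣m : 2 ∣ m
    2∣m = ∣-trans (divides 4 refl) 8∣m
    2∣Q∸1 : 2 ∣ Q ∸ 1
    2∣Q∸1 = ≡1-mod⇒∣∸1 (Q≡1-mod-common-divisor 2∣m (prime∣m⇒prime∣d′ prime[2] 2∣m))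
    Q≡1+h2 : Q ≡ 1 + quotient 2∣Q∸1 * 2
    Q≡1+h2 = trans (sym (suc-pred Q)) (cong suc (_∣_.equality 2∣Q∸1))
    4≤σ : 4 ≤ σ
    4≤σ = ∣⇒≤ (8∣*⇒4∣ (prime∣m⇒prime∣d′ prime[2] 2∣m) 4∤d′ (subst (8 ∣_) m≡d′σ 8∣m))
    1<σ = <-≤-trans (s≤s (s≤s z≤n)) 4≤σ
    2<σ = <-≤-trans (s≤s (s≤s (s≤s z≤n))) 4≤σ
    in-progression-mod8 : ∀ i → i < σ → ∃[ k ] u * (1 + quotient 2∣Q∸1 * 2) ^ k ≡ u + i * d′ [mod 8 ]
    in-progression-mod8 i i<σ =
      k , subst (λ Q → u * Q ^ k ≡ u + i * d′ [mod 8 ]) Q≡1+h2 (mod-∣-weaken 8∣m uQᵏ≡u+id′)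
      where
      k = proj₁ (progression⊆powers i i<σ)
      uQᵏ≡u+id′ = proj₂ (progression⊆powers i i<σ)

bézout-mod : ∀ t τ → .{{_ : NonZero τ}} → ∃[ a ] t * a ≡ gcd t τ [mod τ ]
bézout-mod t τ with Bézout.identity (gcd-GCD t τ)
... | Bézout.+- x y d+yτ≡xt = x , congruent 0 y (trans (+-identityʳ _) (trans (*-comm t x) (sym d+yτ≡xt)))
... | Bézout.-+ x y d+xt≡yτ = x * pred τ , congruent y (t * x) (begin
  t * (x * pred τ) + y * τ          ≡⟨ cong (t * (x * pred τ) +_) d+xt≡yτ ⟨
  t * (x * pred τ) + (d + x * t)    ≡⟨ ring t x (pred τ) d ⟩
  d + t * x * suc (pred τ)          ≡⟨ cong (λ τ → d + t * x * τ) (suc-pred τ) ⟩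
  d + t * x * τ                     ∎)
  where
  d = gcd t τ
  open ≡-Reasoning
  ring : ∀ t x τ d → t * (x * τ) + (d + x * t) ≡ d + t * x * suc τ
  ring = solve-∀

Coset-refl : ∀ {n N β} → .{{_ : NonZero n}} → Coset n N β β
Coset-refl {n} {N} {β} = 0 , cong (_% n) (*-identityʳ β)

Coset-^⊆Coset : ∀ {n N β} → .{{_ : NonZero n}} → ∀ t x → Coset n (N ^ t) β x → Coset n N β x
Coset-^⊆Coset {n} {N} {β} t x (k , βNᵗᵏ≡x) =
  t * k , trans (cong (λ a → (β * a) % n) (sym (^-*-assoc N t k))) βNᵗᵏ≡x

Coset⇒≡-mod : ∀ {n N β x} → .{{_ : NonZero n}} → Coset n N β x → ∃[ k ] x ≡ β * N ^ k [mod n ]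
Coset⇒≡-mod (k , βNᵏ≡x) = k , mod-sym (%≡⇒≡-mod βNᵏ≡x)

equalDiffCoset⇒equalDiffSet : ∀ {n N β} → .{{_ : NonZero n}} →
  EqualDiffCoset n N β → EqualDiffSet n (Coset n N β)
equalDiffCoset⇒equalDiffSet {n} {N} {β} (σ , (0<σ , _) , d , n≡dσ , coset≡progression) =
  σ , 0<σ , d , n≡dσ , β , Coset-refl , coset≡progression

module Setting (q n : ℕ) .{{_ : NonZero n}} .{{_ : NonZero q}} (n⊥q : Coprime n q)
               (γ m : ℕ) (m*g≡n : m * gcd γ n ≡ n) where

  g = gcd γ n

  instance
    g≢0 : NonZero g
    g≢0 = ≢-nonZero (gcd[m,n]≢0 γ n (inj₂ (≢-nonZero⁻¹ n)))
    m≢0 : NonZero m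
    m≢0 = ≢-nonZero (λ m≡0 → ≢-nonZero⁻¹ n (trans (sym m*g≡n) (cong (_* g) m≡0)))

  n≡gm : n ≡ g * m
  n≡gm = trans (sym m*g≡n) (*-comm m g)

  m∣n : m ∣ n
  m∣n = divides g n≡gm

  u = γ / g

  γ≡gu : γ ≡ g * u
  γ≡gu = sym (m*[n/m]≡n (gcd[m,n]∣m γ n))

  u-inv : Invertible m u
  u-inv = coprime⇒invertible (subst (λ k → Coprime k u) n/g≡m (Coprimality.sym (Coprimality.coprime-/gcd γ n)))
    where
    n/g≡m : n / g ≡ m
    n/g≡m = trans (cong (_/ g) (sym m*g≡n)) (m*n/n≡m m g)

  q-inv : Invertible m q
  q-inv = invertible-∣-weaken m∣n (coprime⇒invertible n⊥q)

  uqʲ-inv : ∀ j → Invertible m (u * q ^ j)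
  uqʲ-inv j = *-invertible u-inv (^-invertible j q-inv)

  γ*≡g[u*] : ∀ a → γ * a ≡ g * (u * a)
  γ*≡g[u*] a = trans (cong (_* a) γ≡gu) (*-assoc g u a)

  g*-cancel-mod : ∀ {a b} → g * a ≡ g * b [mod n ] → a ≡ b [mod m ]
  g*-cancel-mod {a} {b} = *-unscale-mod g ∘ subst (λ n → g * a ≡ g * b [mod n ]) n≡gm

  γ*-cong-mod⇔ : ∀ {a b} → γ * a ≡ γ * b [mod n ] ⇔ a ≡ b [mod m ]
  γ*-cong-mod⇔ = β*-cong-mod⇔ {g = g} n≡gm (≡⇒≡-mod γ≡gu) u-inv

  Conditions : ℕ → Set
  Conditions Q = (rad m ∣ Q ∸ 1) × (8 ∣ m → Q % 4 ≡ 1)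

  module _ {Q} .{{_ : NonZero Q}} (conds : Conditions Q) where

    private
      rad∣x = proj₁ conds
      8∣m⇒Q≡1 = proj₂ conds
      x = pred Q
      D = gcd x m
      instance
        D≢0 : NonZero D
        D≢0 = ≢-nonZero (gcd[m,n]≢0 x m (inj₂ (≢-nonZero⁻¹ m)))
        e≢0 : NonZero (m / D)
        e≢0 = ≢-nonZero (n/gcd[m,n]≢0 x m)
      e = m / D

      m≡De : m ≡ D * e
      m≡De = sym (m*[n/m]≡n (gcd[m,n]∣n x m))

      exact : ∀ {r} → Prime r → r ∣ e → r ∣ D × r * D ∤ x
      exact {r} pr r∣e = r∣D , rD∤x
        where
        r∣m : r ∣ m
        r∣m = ∣-trans r∣e (divides D m≡De)
        r∣D : r ∣ D
        r∣D = gcd-greatest (∣-trans (prime∣rad pr r∣m) rad∣x) r∣m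
        rD∣m : r * D ∣ m
        rD∣m = subst (r * D ∣_) (trans (*-comm e D) (sym m≡De)) (*-monoˡ-∣ D r∣e)
        rD∤x : r * D ∤ x
        rD∤x rD∣x = contradiction (subst Prime (∣1⇒≡1 r∣1) pr) ¬prime[1]
          where
          r∣1 : r ∣ 1
          r∣1 = *-cancelʳ-∣ D (subst (r * D ∣_) (sym (*-identityˡ D)) (gcd-greatest rD∣x rD∣m))

      cond : GeneratorConditions x D e
      cond = record
        { D∣x   = gcd[m,n]∣m x m
        ; exact = exact
        ; 8∣⇒4∣ = ≡1-mod⇒∣∸1 ∘ %≡⇒≡-mod ∘ 8∣m⇒Q≡1 ∘ subst (8 ∣_) (sym m≡De)
        }

      order : HasOrder m Q e
      order = subst₂ (λ M a → HasOrder M a e) (sym m≡De) (suc-pred Q) (generator-hasOrder {x} {D} {e} cond)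

      powers : ∀ k → ∃[ y ] Q ^ k ≡ 1 + D * y [mod m ]
      powers k = map₂ (λ [1+x]ᵏ≡ → ≡⇒≡-mod (trans (cong (_^ k) (sym (suc-pred Q))) [1+x]ᵏ≡))
                      (suc-^-≡1+* (gcd[m,n]∣m x m) k)

      onto : ∀ y → ∃[ k ] Q ^ k ≡ 1 + D * y [mod m ]
      onto y = k , subst₂ (λ M a → a ≡ 1 + D * y [mod M ]) (sym m≡De) (cong (_^ k) (suc-pred Q)) 1+xᵏ≡1+Dy
        where
        k = proj₁ (generator-onto {x} {D} {e} cond y)
        1+xᵏ≡1+Dy = proj₂ (generator-onto {x} {D} {e} cond y)

    conditions⇒equalDiffCoset : ∀ {β} j → β ≡ γ * q ^ j [mod n ] → EqualDiffCoset n Q β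
    conditions⇒equalDiffCoset {β} j β≡γqʲ =
      generator⇒equalDiffCoset {g = g} {D = D} {e} n≡gm m≡De β≡g[uqʲ] (uqʲ-inv j) order powers onto
      where
      β≡g[uqʲ] : β ≡ g * (u * q ^ j) [mod n ]
      β≡g[uqʲ] = subst (β ≡_[mod n ]) (γ*≡g[u*] (q ^ j)) β≡γqʲ

  module _ {Q} .{{_ : NonZero Q}} (Q-inv : Invertible m Q) (γ-equalDiff : EqualDiffCoset n Q γ) where

    private
      σ = proj₁ γ-equalDiff
      0<σ = proj₁ (proj₁ (proj₂ γ-equalDiff))
      d = proj₁ (proj₂ (proj₂ γ-equalDiff))
      n≡dσ = proj₁ (proj₂ (proj₂ (proj₂ γ-equalDiff)))
      coset⇔progression = proj₂ (proj₂ (proj₂ (proj₂ γ-equalDiff)))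
      instance
        σ≢0 : NonZero σ
        σ≢0 = >-nonZero 0<σ

      γQᵏ≡γ+id : ∀ i → i < σ → ∃[ k ] γ * Q ^ k ≡ γ + i * d [mod n ]
      γQᵏ≡γ+id i i<σ = map₂ %≡⇒≡-mod (Equivalence.from (coset⇔progression (γ + i * d)) (i , i<σ , refl))

      g∣d : g ∣ d
      g∣d with σ ≟ 1
      ... | yes σ≡1 = subst (g ∣_) (trans n≡dσ (trans (cong (d *_) σ≡1) (*-identityʳ d))) (gcd[m,n]∣n γ n)
      ... | no  σ≢1 = ∣m+n∣m⇒∣n (subst (g ∣_) (cong (γ +_) (*-identityˡ d))
                        (∣-resp-mod (gcd[m,n]∣n γ n) (proj₂ (γQᵏ≡γ+id 1 1<σ)) (∣m⇒∣m*n _ (gcd[m,n]∣m γ n))))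
                        (gcd[m,n]∣m γ n)
        where
        1<σ : 1 < σ
        1<σ = ≤∧≢⇒< 0<σ (σ≢1 ∘ sym)

      d′ = quotient g∣d

      m≡d′σ : m ≡ d′ * σ
      m≡d′σ = *-cancelˡ-≡ m (d′ * σ) g (begin
        g * m          ≡⟨ n≡gm ⟨
        n              ≡⟨ n≡dσ ⟩
        d * σ          ≡⟨ cong (_* σ) (_∣_.equality g∣d) ⟩
        d′ * g * σ     ≡⟨ xy∙z≈y∙xz d′ g σ ⟩
        g * (d′ * σ)   ∎)
        where open ≡-Reasoning

      γ+id≡g[u+id′] : ∀ i → γ + i * d ≡ g * (u + i * d′)
      γ+id≡g[u+id′] i = begin
        γ + i * d              ≡⟨ cong₂ (λ a b → a + i * b) γ≡gu (_∣_.equality g∣d) ⟩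
        g * u + i * (d′ * g)   ≡⟨ cong (g * u +_) (x∙yz≈z∙xy i d′ g) ⟩
        g * u + g * (i * d′)   ≡⟨ *-distribˡ-+ g u (i * d′) ⟨
        g * (u + i * d′)       ∎
        where open ≡-Reasoning

      progression⊆powers : ∀ i → i < σ → ∃[ k ] u * Q ^ k ≡ u + i * d′ [mod m ]
      progression⊆powers i i<σ =
        k , g*-cancel-mod (subst₂ _≡_[mod n ] (γ*≡g[u*] (Q ^ k)) (γ+id≡g[u+id′] i) (proj₂ (γQᵏ≡γ+id i i<σ)))
        where k = proj₁ (γQᵏ≡γ+id i i<σ)

      uQ∈progression : ∃[ i ] u * Q ≡ u + i * d′ [mod m ]
      uQ∈progression =
        i , mod-sym (g*-cancel-mod (subst₂ _≡_[mod n ] (γ+id≡g[u+id′] i) (γ*≡g[u*] Q) (%≡⇒≡-mod γ+id≡γQ)))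
        where
        γQ∈coset : Coset n Q γ (γ * Q)
        γQ∈coset = 1 , cong (λ z → (γ * z) % n) (*-identityʳ Q)
        i = proj₁ (Equivalence.to (coset⇔progression (γ * Q)) γQ∈coset)
        γ+id≡γQ = proj₂ (proj₂ (Equivalence.to (coset⇔progression (γ * Q)) γQ∈coset))

    equalDiffCoset⇒conditions : Conditions Q
    equalDiffCoset⇒conditions =
      rad∣Q∸1 m≡d′σ u-inv Q-inv progression⊆powers uQ∈progression ,
      8∣m⇒Q≡1-mod4 m≡d′σ u-inv Q-inv progression⊆powers uQ∈progression

  module _ {τ} (γ-order : IsOrder n q γ τ) {t} (0<t : 0 < t) where

    private
      t′ = gcd t τ
      instance
        τ≢0 : NonZero τ
        τ≢0 = >-nonZero (proj₁ γ-order)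
        t′≢0 : NonZero t′
        t′≢0 = ≢-nonZero (gcd[m,n]≢0 t τ (inj₁ (≢-nonZero⁻¹ t {{>-nonZero 0<t}})))

      q-order : HasOrder m q τ
      q-order = isOrder⇒hasOrder {g = g} n≡gm (≡⇒≡-mod γ≡gu) u-inv γ-order

      γqⁱ≡γqʲ⇔ : ∀ {i j} → γ * q ^ i ≡ γ * q ^ j [mod n ] ⇔ i ≡ j [mod τ ]
      γqⁱ≡γqʲ⇔ = mk⇔ (^-cancel-order q-order q-inv ∘ Equivalence.to γ*-cong-mod⇔)
                     (Equivalence.from γ*-cong-mod⇔ ∘ ^-cong-order q-order)

      γqʲQᵏ≡γqʲ⁺ᵗᵏ : ∀ j k → γ * q ^ j * (q ^ t) ^ k ≡ γ * q ^ (j + t * k)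
      γqʲQᵏ≡γqʲ⁺ᵗᵏ j k = begin
        γ * q ^ j * (q ^ t) ^ k    ≡⟨ *-assoc γ (q ^ j) _ ⟩
        γ * (q ^ j * (q ^ t) ^ k)  ≡⟨ cong (λ a → γ * (q ^ j * a)) (^-*-assoc q t k) ⟩
        γ * (q ^ j * q ^ (t * k))  ≡⟨ cong (γ *_) (^-distribˡ-+-* q j (t * k)) ⟨
        γ * q ^ (j + t * k)        ∎
        where open ≡-Reasoning

      a = proj₁ (bézout-mod t τ)
      ta≡t′ = proj₂ (bézout-mod t τ)

      exponent≡k : ∀ k → k % t′ + t * (a * (k / t′)) ≡ k [mod τ ]
      exponent≡k k = begin
        k % t′ + t * (a * (k / t′))  ≡⟨ cong (k % t′ +_) (*-assoc t a (k / t′)) ⟨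
        k % t′ + t * a * (k / t′)    ≈⟨ +-cong-mod (mod-refl {a = k % t′}) (*-congʳ-mod (k / t′) ta≡t′) ⟩
        k % t′ + t′ * (k / t′)       ≡⟨ cong (k % t′ +_) (*-comm t′ (k / t′)) ⟩
        k % t′ + k / t′ * t′         ≡⟨ m≡m%n+[m/n]*n k t′ ⟨
        k                            ∎
        where open ≡-mod-Reasoning τ

      cover : ∀ x → Coset n q γ x ⇔ (∃[ j ] (j < t′ × Coset n (q ^ t) (γ * q ^ j) x))
      cover x = mk⇔ to from
        where
        to : Coset n q γ x → ∃[ j ] (j < t′ × Coset n (q ^ t) (γ * q ^ j) x)
        to (k , γqᵏ≡x) = k % t′ , m%n<n k t′ , a * (k / t′) , (begin
          γ * q ^ (k % t′) * (q ^ t) ^ (a * (k / t′)) % n  ≡⟨ cong (_% n) (γqʲQᵏ≡γqʲ⁺ᵗᵏ (k % t′) (a * (k / t′))) ⟩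
          γ * q ^ (k % t′ + t * (a * (k / t′))) % n         ≡⟨ ≡-mod⇒%≡ (Equivalence.from γqⁱ≡γqʲ⇔ (exponent≡k k)) ⟩
          γ * q ^ k % n                                      ≡⟨ γqᵏ≡x ⟩
          x % n                                              ∎)
          where open ≡-Reasoning
        from : ∃[ j ] (j < t′ × Coset n (q ^ t) (γ * q ^ j) x) → Coset n q γ x
        from (j , _ , k , γqʲQᵏ≡x) = j + t * k , trans (cong (_% n) (sym (γqʲQᵏ≡γqʲ⁺ᵗᵏ j k))) γqʲQᵏ≡x

      disjoint : ∀ j j′ x → j < t′ → j′ < t′ →
        Coset n (q ^ t) (γ * q ^ j) x → Coset n (q ^ t) (γ * q ^ j′) x → j ≡ j′
      disjoint j j′ x j<t′ j′<t′ (k , γqʲQᵏ≡x) (k′ , γqʲ′Qᵏ′≡x) = begin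
        j         ≡⟨ m<n⇒m%n≡m j<t′ ⟨
        j % t′    ≡⟨ ≡-mod⇒%≡ j≡j′ ⟩
        j′ % t′   ≡⟨ m<n⇒m%n≡m j′<t′ ⟩
        j′        ∎
        where
        open ≡-Reasoning
        γqʲ⁺ᵗᵏ≡x : ∀ j k → (γ * q ^ j * (q ^ t) ^ k) % n ≡ x % n → γ * q ^ (j + t * k) ≡ x [mod n ]
        γqʲ⁺ᵗᵏ≡x j k γqʲQᵏ≡x = %≡⇒≡-mod (trans (cong (_% n) (sym (γqʲQᵏ≡γqʲ⁺ᵗᵏ j k))) γqʲQᵏ≡x)
        exponents≡ : j + t * k ≡ j′ + t * k′ [mod τ ]
        exponents≡ = Equivalence.to γqⁱ≡γqʲ⇔ (mod-trans (γqʲ⁺ᵗᵏ≡x j k γqʲQᵏ≡x) (mod-sym (γqʲ⁺ᵗᵏ≡x j′ k′ γqʲ′Qᵏ′≡x)))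
        +t*≡ : ∀ i k → i + t * k ≡ i [mod t′ ]
        +t*≡ i k = ∣⇒+-≡-mod i (∣m⇒∣m*n k (gcd[m,n]∣m t τ))
        j≡j′ : j ≡ j′ [mod t′ ]
        j≡j′ = mod-trans (mod-sym (+t*≡ j k)) (mod-trans (mod-∣-weaken (gcd[m,n]∣n t τ) exponents≡) (+t*≡ j′ k′))

    conditions⇒decomposition : Conditions (q ^ t) →
      EqualDiffDecomposition n (Coset n q γ) t′ (λ j → Coset n (q ^ t) (γ * q ^ j))
    conditions⇒decomposition conds = cover , disjoint , λ j _ →
      equalDiffCoset⇒equalDiffSet (conditions⇒equalDiffCoset {{m^n≢0 q t}} conds j mod-refl)

-- The theorem uses nothing about q being a prime power beyond q ≠ 0.
primePower⇒nonZero : ∀ {q} → IsPrimePower q → NonZero q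
primePower⇒nonZero (p , e , pp , _ , refl) = m^n≢0 p e {{prime⇒nonZero pp}}

lemma4p2 : (q n : ℕ) → .{{_ : NonZero n}} → IsPrimePower q → Coprime n q →
    (γ : ℕ) → γ < n → (nγ : ℕ) → nγ * gcd γ n ≡ n →
    (τ : ℕ) → IsOrder n q γ τ → (t : ℕ) → 0 < t →
    ((∀ β → β < n → (∀ x → Coset n (q ^ t) β x → Coset n q γ x) → EqualDiffCoset n (q ^ t) β)
      ⇔ ((rad nγ ∣ q ^ t ∸ 1) × (8 ∣ nγ → q ^ t % 4 ≡ 1)))
    × (((rad nγ ∣ q ^ t ∸ 1) × (8 ∣ nγ → q ^ t % 4 ≡ 1)) →
      EqualDiffDecomposition n (Coset n q γ) (gcd t τ) (λ j → Coset n (q ^ t) (γ * q ^ j)))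
lemma4p2 q n q-primePower n⊥q γ γ<n nγ nγ*g≡n τ γ-order t 0<t =
  mk⇔ (λ all-equalDiff → equalDiffCoset⇒conditions (^-invertible t q-inv)
                            (all-equalDiff γ γ<n (Coset-^⊆Coset {N = q} {γ} t)))
      (λ conds β _ ⊆γ-coset → uncurry (conditions⇒equalDiffCoset conds)
                                 (Coset⇒≡-mod {N = q} {γ} (⊆γ-coset β Coset-refl)))
  , conditions⇒decomposition γ-order 0<t
  where
  instance
    _ = primePower⇒nonZero q-primePower
    _ = m^n≢0 q t
  open Setting q n n⊥q γ nγ nγ*g≡n
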